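{- The degrees of $\omega$-mass problems $\mathcal{M}_\omega$, ordered by $\le_{\mathcal{M}_\omega}$, form a Brouwer algebra.
   Context: An $\omega$-mass problem is a sequence $(\mathcal{A}_i)_{i\in\omega}$ of subsets of $\omega^\omega$. For $\omega$-mass problems, $(\mathcal{A}_i)_{i\in\omega}\le_{\mathcal{M}_\omega}(\mathcal{B}_i)_{i\in\omega}$ iff there exists a partial Turing functional $\Phi$ such that for every $n\in\omega$, $\Phi(n^\frown\mathcal{B}_n)\subseteq\mathcal{A}_n$, where $n^\frown\mathcal{B}_n=\{n^\frown f:f\in\mathcal{B}_n\}$ and $n^\frown f$ is the function with first value $n$ followed by $f$. $\mathcal{M}_\omega$ is the set of equivalence classes under the induced equivalence. A Brouwer algebra is a bounded distributive lattice (join $\oplus$, meet $\otimes$) with an operation $\to$ such that $x\oplus y\ge z$ iff $y\ge x\to z$. -}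

module Defs where

open import Level using (Level; _⊔_) renaming (suc to lsuc; zero to lzero)
open import Data.Nat using (ℕ; zero; suc; _<_)
open import Data.Fin using (Fin)
open import Data.Vec using (Vec; []; _∷_; lookup)
open import Data.Product using (Σ; _×_; _,_)
open import Function.Bundles using (_⇔_)
open import Relation.Binary.PropositionalEquality using (_≡_)

-- Baire space and oracle computation (Kleene's oracle μ-recursive
-- functions, the standard model of partial Turing functionals).

Baire : Set
Baire = ℕ → ℕ

_≈B_ : Baire → Baire → Set
f ≈B g = ∀ x → f x ≡ g x

data Code : ℕ → Set where
  zer    : ∀ {n} → Code n
  succ   : Code 1
  proj   : ∀ {n} → Fin n → Code n
  oracle : Code 1
  comp   : ∀ {m n} → Code m → Vec (Code n) m → Code n
  prec   : ∀ {n} → Code n → Code (suc (suc n)) → Code (suc n)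
  mu     : ∀ {n} → Code (suc n) → Code n

mutual
  data Eval (g : Baire) : ∀ {n} → Code n → Vec ℕ n → ℕ → Set where
    ev-zer    : ∀ {n} {xs : Vec ℕ n} → Eval g zer xs 0
    ev-succ   : ∀ {x} → Eval g succ (x ∷ []) (suc x)
    ev-proj   : ∀ {n} {i : Fin n} {xs} → Eval g (proj i) xs (lookup xs i)
    ev-oracle : ∀ {x} → Eval g oracle (x ∷ []) (g x)
    ev-comp   : ∀ {m n} {f : Code m} {hs : Vec (Code n) m} {xs ys y} →
                EvalVec g hs xs ys → Eval g f ys y → Eval g (comp f hs) xs y
    ev-prec0  : ∀ {n} {f : Code n} {h : Code (suc (suc n))} {xs y} →
                Eval g f xs y → Eval g (prec f h) (0 ∷ xs) y
    ev-precS  : ∀ {n} {f : Code n} {h : Code (suc (suc n))} {xs k r y} →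
                Eval g (prec f h) (k ∷ xs) r → Eval g h (k ∷ r ∷ xs) y →
                Eval g (prec f h) (suc k ∷ xs) y
    ev-mu     : ∀ {n} {f : Code (suc n)} {xs y} →
                Eval g f (y ∷ xs) 0 →
                (∀ z → z < y → Σ ℕ (λ k → Eval g f (z ∷ xs) (suc k))) →
                Eval g (mu f) xs y

  data EvalVec (g : Baire) {n : ℕ} : ∀ {m} → Vec (Code n) m → Vec ℕ n → Vec ℕ m → Set where
    evv-[] : ∀ {xs} → EvalVec g [] xs []
    evv-∷  : ∀ {m} {c : Code n} {cs : Vec (Code n) m} {xs y ys} →
             Eval g c xs y → EvalVec g cs xs ys → EvalVec g (c ∷ cs) xs (y ∷ ys)

-- A partial Turing functional Φ : ω^ω ⇀ ω^ω is given by a unary oracle code: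
-- Φ(g)(x) = φ^g(x).
TuringFunctional : Set
TuringFunctional = Code 1

_⟦_⟧↦_ : TuringFunctional → Baire → Baire → Set
Φ ⟦ g ⟧↦ h = ∀ x → Eval g Φ (x ∷ []) (h x)

record MassProblem : Set₁ where
  field
    _∋_  : Baire → Set
    ext  : ∀ {f g} → f ≈B g → _∋_ f → _∋_ g
open MassProblem public

ωMassProblem : Set₁
ωMassProblem = ℕ → MassProblem

_⌢_ : ℕ → Baire → Baire
(n ⌢ f) zero    = n
(n ⌢ f) (suc x) = f x

_maps_into_ : TuringFunctional → (Baire → Set) → MassProblem → Set
Φ maps X into A = ∀ g → X g → Σ Baire (λ h → (Φ ⟦ g ⟧↦ h) × (A ∋ h))

_≤Mω_ : ωMassProblem → ωMassProblem → Set
𝒜 ≤Mω ℬ = Σ TuringFunctional λ Φ →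
  ∀ n → Φ maps (λ g → Σ Baire λ f → (ℬ n ∋ f) × (g ≈B (n ⌢ f))) into 𝒜 n

-- A Brouwer algebra presented on a preordered type (the algebra is the
-- quotient by x ≤ y ≤ x): a bounded lattice with join ⊕ and meet ⊗
-- (characterised as least upper / greatest lower bounds with respect to ≤),
-- distributive, with an implication → satisfying
--   x ⊕ y ≥ z  iff  y ≥ x → z.

record IsBrouwerAlgebra {a ℓ : Level} (A : Set a) (_≤_ : A → A → Set ℓ) : Set (a ⊔ ℓ) where
  field
    refl  : ∀ {x} → x ≤ x
    trans : ∀ {x y z} → x ≤ y → y ≤ z → x ≤ z
    _⊕_ _⊗_ _⇒_ : A → A → A
    𝟎 𝟏 : A
    𝟎-least    : ∀ x → 𝟎 ≤ x
    𝟏-greatest : ∀ x → x ≤ 𝟏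
    ⊕-upperˡ : ∀ x y → x ≤ (x ⊕ y)
    ⊕-upperʳ : ∀ x y → y ≤ (x ⊕ y)
    ⊕-least  : ∀ x y z → x ≤ z → y ≤ z → (x ⊕ y) ≤ z
    ⊗-lowerˡ : ∀ x y → (x ⊗ y) ≤ x
    ⊗-lowerʳ : ∀ x y → (x ⊗ y) ≤ y
    ⊗-greatest : ∀ x y z → z ≤ x → z ≤ y → z ≤ (x ⊗ y)
    distrib  : ∀ x y z → (x ⊗ (y ⊕ z)) ≤ ((x ⊗ y) ⊕ (x ⊗ z))
    ⇒-adj    : ∀ x y z → (z ≤ (x ⊕ y)) ⇔ ((x ⇒ z) ≤ y)

-- Reductions see the index n as the first oracle value, and every lattice law is witnessed by
-- one explicit functional: 𝟎 is the full and 𝟏 the empty problem, a ⊕ b interleaves a solution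
-- of a with one of b, and a ⊗ b consists of the solutions of a tagged by 0 and those of b tagged
-- by 1 (for ⊗-greatest the functional branches lazily on the tag).
--
-- The implication a ⇒ c at n consists of the h such that one fixed decoder turns n ⌢ (g ⊕ h)
-- into a solution of c for every solution g of a. If Ψ reduces c to a ⊕ b, a solution h of b is
-- sent to the total table whose entry at (x, m, σ) runs Ψ on x with μ-searches cut off at m,
-- answering oracle queries from n ⌢ h and from the finite sequence σ, and is undefined if the run
-- gets stuck. Given g, the decoder reads the entries for the initial segments of g and returns the
-- first defined one. Bounded runs are sound, monotone and complete along the initial segments, so
-- this is the value of Ψ on n ⌢ (g ⊕ h). Conversely, a reduction of a ⇒ c to b composed with the
-- decoder reduces c to a ⊕ b.

module Submission where

open import Defs
open import Data.Nat using (ℕ; zero; suc; _<_; _≤_; _+_; _∸_; z≤n; s≤s; pred; _⊔_; _<?_)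
open import Data.Nat.GeneralisedArithmetic using (fold)
open import Data.Nat.Properties
open import Data.Fin using (Fin; zero; suc; _↑ʳ_)
open import Data.Vec using (Vec; []; _∷_; lookup; tabulate; _++_)
open import Data.Vec.Properties using (tabulate∘lookup; tabulate-cong; lookup-++ʳ)
open import Data.Product using (Σ; _×_; _,_; proj₁; proj₂)
open import Data.Sum using (_⊎_; inj₁; inj₂)
open import Data.Empty using (⊥)
open import Data.Unit using (⊤; tt)
open import Relation.Nullary using (yes; no; contradiction)
open import Relation.Binary.PropositionalEquality
open import Relation.Binary.Definitions using (tri<; tri≈; tri>)
open import Function.Bundles using (mk⇔)

-- Oracle computations

mutual
  eval-resp-≈B : ∀ {g g' n} {c : Code n} {xs y} → g ≈B g' → Eval g c xs y → Eval g' c xs y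
  eval-resp-≈B e ev-zer = ev-zer
  eval-resp-≈B e ev-succ = ev-succ
  eval-resp-≈B e ev-proj = ev-proj
  eval-resp-≈B {g' = g'} e (ev-oracle {x}) = subst (Eval g' oracle (x ∷ [])) (sym (e x)) ev-oracle
  eval-resp-≈B e (ev-comp v p) = ev-comp (evalVec-resp-≈B e v) (eval-resp-≈B e p)
  eval-resp-≈B e (ev-prec0 p) = ev-prec0 (eval-resp-≈B e p)
  eval-resp-≈B e (ev-precS p q) = ev-precS (eval-resp-≈B e p) (eval-resp-≈B e q)
  eval-resp-≈B e (ev-mu p w) =
    ev-mu (eval-resp-≈B e p) (λ z z<y → proj₁ (w z z<y) , eval-resp-≈B e (proj₂ (w z z<y)))

  evalVec-resp-≈B : ∀ {g g' n m} {cs : Vec (Code n) m} {xs ys} →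
                    g ≈B g' → EvalVec g cs xs ys → EvalVec g' cs xs ys
  evalVec-resp-≈B e evv-[] = evv-[]
  evalVec-resp-≈B e (evv-∷ p v) = evv-∷ (eval-resp-≈B e p) (evalVec-resp-≈B e v)

mutual
  eval-deterministic : ∀ {g n} {c : Code n} {xs y y'} → Eval g c xs y → Eval g c xs y' → y ≡ y'
  eval-deterministic ev-zer ev-zer = refl
  eval-deterministic ev-succ ev-succ = refl
  eval-deterministic ev-proj ev-proj = refl
  eval-deterministic ev-oracle ev-oracle = refl
  eval-deterministic (ev-comp v p) (ev-comp v' p') with evalVec-deterministic v v'
  ... | refl = eval-deterministic p p'
  eval-deterministic (ev-prec0 p) (ev-prec0 p') = eval-deterministic p p'
  eval-deterministic (ev-precS p q) (ev-precS p' q') with eval-deterministic p p'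
  ... | refl = eval-deterministic q q'
  eval-deterministic {y = y} {y'} (ev-mu p w) (ev-mu p' w') with <-cmp y y'
  ... | tri< y<y' _ _ = contradiction (eval-deterministic p (proj₂ (w' y y<y'))) 0≢1+n
  ... | tri≈ _ y≡y' _ = y≡y'
  ... | tri> _ _ y>y' = contradiction (eval-deterministic p' (proj₂ (w y' y>y'))) 0≢1+n

  evalVec-deterministic : ∀ {g n m} {cs : Vec (Code n) m} {xs ys ys'} →
                          EvalVec g cs xs ys → EvalVec g cs xs ys' → ys ≡ ys'
  evalVec-deterministic evv-[] evv-[] = refl
  evalVec-deterministic (evv-∷ p v) (evv-∷ p' v') =
    cong₂ _∷_ (eval-deterministic p p') (evalVec-deterministic v v')

mutual
  _[oracle≔_] : ∀ {n} → Code n → Code 1 → Code n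
  zer [oracle≔ e ] = zer
  succ [oracle≔ e ] = succ
  proj i [oracle≔ e ] = proj i
  oracle [oracle≔ e ] = e
  comp f hs [oracle≔ e ] = comp (f [oracle≔ e ]) (hs [oracleᵛ≔ e ])
  prec f h [oracle≔ e ] = prec (f [oracle≔ e ]) (h [oracle≔ e ])
  mu f [oracle≔ e ] = mu (f [oracle≔ e ])

  _[oracleᵛ≔_] : ∀ {n m} → Vec (Code n) m → Code 1 → Vec (Code n) m
  [] [oracleᵛ≔ e ] = []
  (c ∷ cs) [oracleᵛ≔ e ] = c [oracle≔ e ] ∷ cs [oracleᵛ≔ e ]

module _ {g k : Baire} {e : Code 1} (e↦k : e ⟦ g ⟧↦ k) where
  mutual
    eval-[oracle≔] : ∀ {n} {c : Code n} {xs y} → Eval k c xs y → Eval g (c [oracle≔ e ]) xs y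
    eval-[oracle≔] ev-zer = ev-zer
    eval-[oracle≔] ev-succ = ev-succ
    eval-[oracle≔] ev-proj = ev-proj
    eval-[oracle≔] (ev-oracle {x}) = e↦k x
    eval-[oracle≔] (ev-comp v p) = ev-comp (evalVec-[oracleᵛ≔] v) (eval-[oracle≔] p)
    eval-[oracle≔] (ev-prec0 p) = ev-prec0 (eval-[oracle≔] p)
    eval-[oracle≔] (ev-precS p q) = ev-precS (eval-[oracle≔] p) (eval-[oracle≔] q)
    eval-[oracle≔] (ev-mu p w) =
      ev-mu (eval-[oracle≔] p) (λ z z<y → proj₁ (w z z<y) , eval-[oracle≔] (proj₂ (w z z<y)))

    evalVec-[oracleᵛ≔] : ∀ {n m} {cs : Vec (Code n) m} {xs ys} →
                         EvalVec k cs xs ys → EvalVec g (cs [oracleᵛ≔ e ]) xs ys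
    evalVec-[oracleᵛ≔] evv-[] = evv-[]
    evalVec-[oracleᵛ≔] (evv-∷ p v) = evv-∷ (eval-[oracle≔] p) (evalVec-[oracleᵛ≔] v)

  ⟦⟧↦-compose : ∀ {Φ h} → Φ ⟦ k ⟧↦ h → (Φ [oracle≔ e ]) ⟦ g ⟧↦ h
  ⟦⟧↦-compose Φ↦h x = eval-[oracle≔] (Φ↦h x)

-- Primitive recursive codes

#0 : ∀ {n} → Code (suc n)
#0 = proj zero

#1 : ∀ {n} → Code (suc (suc n))
#1 = proj (suc zero)

#2 : ∀ {n} → Code (suc (suc (suc n)))
#2 = proj (suc (suc zero))

#3 : ∀ {n} → Code (suc (suc (suc (suc n))))
#3 = proj (suc (suc (suc zero)))

app₁ : ∀ {n} → Code 1 → Code n → Code n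
app₁ f a = comp f (a ∷ [])

app₂ : ∀ {n} → Code 2 → Code n → Code n → Code n
app₂ f a b = comp f (a ∷ b ∷ [])

app₃ : ∀ {n} → Code 3 → Code n → Code n → Code n → Code n
app₃ f a b c = comp f (a ∷ b ∷ c ∷ [])

module _ {g : Baire} {n : ℕ} {xs : Vec ℕ n} where
  eval-app₁ : ∀ {f a u v} → Eval g a xs u → Eval g f (u ∷ []) v → Eval g (app₁ f a) xs v
  eval-app₁ a↦u f↦v = ev-comp (evv-∷ a↦u evv-[]) f↦v

  eval-app₂ : ∀ {f a b u w v} →
              Eval g a xs u → Eval g b xs w → Eval g f (u ∷ w ∷ []) v → Eval g (app₂ f a b) xs v
  eval-app₂ a↦u b↦w f↦v = ev-comp (evv-∷ a↦u (evv-∷ b↦w evv-[])) f↦v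

  eval-app₃ : ∀ {f a b c u w t v} → Eval g a xs u → Eval g b xs w → Eval g c xs t →
              Eval g f (u ∷ w ∷ t ∷ []) v → Eval g (app₃ f a b c) xs v
  eval-app₃ a↦u b↦w c↦t f↦v = ev-comp (evv-∷ a↦u (evv-∷ b↦w (evv-∷ c↦t evv-[]))) f↦v

numeral : ∀ {n} → ℕ → Code n
numeral zero = zer
numeral (suc k) = app₁ succ (numeral k)

eval-numeral : ∀ {g n} {xs : Vec ℕ n} k → Eval g (numeral k) xs k
eval-numeral zero = ev-zer
eval-numeral (suc k) = eval-app₁ (eval-numeral k) ev-succ

predᶜ : Code 1
predᶜ = prec zer #0

eval-pred : ∀ {g} x → Eval g predᶜ (x ∷ []) (pred x)
eval-pred zero = ev-prec0 ev-zer
eval-pred (suc x) = ev-precS (eval-pred x) ev-proj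

addᶜ : Code 2
addᶜ = prec #0 (app₁ succ #1)

eval-add : ∀ {g} a b → Eval g addᶜ (a ∷ b ∷ []) (a + b)
eval-add zero b = ev-prec0 ev-proj
eval-add (suc a) b = ev-precS (eval-add a b) (eval-app₁ ev-proj ev-succ)

monusᶜ : Code 2
monusᶜ = app₂ (prec #0 (app₁ predᶜ #1)) #1 #0

eval-monus : ∀ {g} a b → Eval g monusᶜ (a ∷ b ∷ []) (a ∸ b)
eval-monus {g} a b = eval-app₂ ev-proj ev-proj (by-recursion b)
  where
  by-recursion : ∀ b → Eval g (prec #0 (app₁ predᶜ #1)) (b ∷ a ∷ []) (a ∸ b)
  by-recursion zero = ev-prec0 ev-proj
  by-recursion (suc b) =
    subst (Eval g _ (suc b ∷ a ∷ [])) (pred[m∸n]≡m∸[1+n] a b)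
      (ev-precS (by-recursion b) (eval-app₁ ev-proj (eval-pred (a ∸ b))))

ifZero : ℕ → ℕ → ℕ → ℕ
ifZero zero u v = u
ifZero (suc _) u v = v

ifZeroᶜ : Code 3
ifZeroᶜ = prec #0 #3

eval-ifZero : ∀ {g} b u v → Eval g ifZeroᶜ (b ∷ u ∷ v ∷ []) (ifZero b u v)
eval-ifZero zero u v = ev-prec0 ev-proj
eval-ifZero (suc b) u v = ev-precS (eval-ifZero b u v) ev-proj

isZero : ℕ → ℕ
isZero zero = 1
isZero (suc _) = 0

isZeroᶜ : Code 1
isZeroᶜ = prec (numeral 1) zer

eval-isZero : ∀ {g} b → Eval g isZeroᶜ (b ∷ []) (isZero b)
eval-isZero zero = ev-prec0 (eval-numeral 1)
eval-isZero (suc b) = ev-precS (eval-isZero b) ev-zer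

double : ℕ → ℕ
double zero = 0
double (suc n) = suc (suc (double n))

doubleᶜ : Code 1
doubleᶜ = prec zer (app₁ succ (app₁ succ #1))

eval-double : ∀ {g} x → Eval g doubleᶜ (x ∷ []) (double x)
eval-double zero = ev-prec0 ev-zer
eval-double (suc x) = ev-precS (eval-double x) (eval-app₁ (eval-app₁ ev-proj ev-succ) ev-succ)

parity : ℕ → ℕ
parity zero = 0
parity (suc n) = isZero (parity n)

parityᶜ : Code 1
parityᶜ = prec zer (app₁ isZeroᶜ #1)

eval-parity : ∀ {g} x → Eval g parityᶜ (x ∷ []) (parity x)
eval-parity zero = ev-prec0 ev-zer
eval-parity (suc x) = ev-precS (eval-parity x) (eval-app₁ ev-proj (eval-isZero (parity x)))

half : ℕ → ℕ
half zero = 0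
half (suc n) = half n + parity n

halfᶜ : Code 1
halfᶜ = prec zer (app₂ addᶜ #1 (app₁ parityᶜ #0))

eval-half : ∀ {g} x → Eval g halfᶜ (x ∷ []) (half x)
eval-half zero = ev-prec0 ev-zer
eval-half (suc x) =
  ev-precS (eval-half x) (eval-app₂ ev-proj (eval-app₁ ev-proj (eval-parity x)) (eval-add (half x) (parity x)))

parity-double : ∀ i → parity (double i) ≡ 0
parity-double zero = refl
parity-double (suc i) rewrite parity-double i = refl

parity-1+double : ∀ i → parity (suc (double i)) ≡ 1
parity-1+double i rewrite parity-double i = refl

half-double : ∀ i → half (double i) ≡ i
half-double zero = refl
half-double (suc i) rewrite parity-double i | half-double i | +-identityʳ i = +-comm i 1

half-1+double : ∀ i → half (suc (double i)) ≡ i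
half-1+double i rewrite parity-double i | half-double i = +-identityʳ i

data EvenOdd : ℕ → Set where
  even : ∀ i → EvenOdd (double i)
  odd  : ∀ i → EvenOdd (suc (double i))

evenOdd : ∀ q → EvenOdd q
evenOdd zero = even 0
evenOdd (suc q) with evenOdd q
... | even i = odd i
... | odd i = even (suc i)

triangle : ℕ → ℕ
triangle zero = 0
triangle (suc j) = triangle j + suc j

triangleᶜ : Code 1
triangleᶜ = prec zer (app₂ addᶜ #1 (app₁ succ #0))

eval-triangle : ∀ {g} x → Eval g triangleᶜ (x ∷ []) (triangle x)
eval-triangle zero = ev-prec0 ev-zer
eval-triangle (suc x) =
  ev-precS (eval-triangle x) (eval-app₂ ev-proj (eval-app₁ ev-proj ev-succ) (eval-add (triangle x) (suc x)))

triangle-mono-≤ : ∀ {a b} → a ≤ b → triangle a ≤ triangle b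
triangle-mono-≤ z≤n = z≤n
triangle-mono-≤ (s≤s a≤b) = +-mono-≤ (triangle-mono-≤ a≤b) (s≤s a≤b)

-- Cantor pairing: pair a b is the b-th entry of the (a + b)-th diagonal.
pair : ℕ → ℕ → ℕ
pair a b = triangle (a + b) + b

pairᶜ : Code 2
pairᶜ = app₂ addᶜ (app₁ triangleᶜ (app₂ addᶜ #0 #1)) #1

eval-pair : ∀ {g} a b → Eval g pairᶜ (a ∷ b ∷ []) (pair a b)
eval-pair a b =
  eval-app₂ (eval-app₁ (eval-app₂ ev-proj ev-proj (eval-add a b)) (eval-triangle (a + b))) ev-proj
            (eval-add (triangle (a + b)) b)

OnDiagonal : ℕ → ℕ → Set
OnDiagonal q d = triangle d ≤ q × q < triangle (suc d)

onDiagonal-unique : ∀ {q d d'} → OnDiagonal q d → OnDiagonal q d' → d ≡ d'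
onDiagonal-unique {d = d} {d'} (t≤q , q<t) (t'≤q , q<t') with <-cmp d d'
... | tri< d<d' _ _ = contradiction (≤-trans (triangle-mono-≤ d<d') t'≤q) (<⇒≱ q<t)
... | tri≈ _ d≡d' _ = d≡d'
... | tri> _ _ d>d' = contradiction (≤-trans (triangle-mono-≤ d>d') t≤q) (<⇒≱ q<t')

diagonal : ∀ q → Σ ℕ (OnDiagonal q)
diagonal zero = 0 , z≤n , s≤s z≤n
diagonal (suc q) with diagonal q
... | d , t≤q , q<t with suc q <? triangle (suc d)
...   | yes 1+q<t = d , ≤-trans t≤q (n≤1+n q) , 1+q<t
...   | no 1+q≮t = suc d , ≮⇒≥ 1+q≮t , ≤-<-trans q<t (m<m+n (triangle (suc d)) (s≤s z≤n))

unpair₂ : ℕ → ℕ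
unpair₂ q = q ∸ triangle (proj₁ (diagonal q))

unpair₁ : ℕ → ℕ
unpair₁ q = proj₁ (diagonal q) ∸ unpair₂ q

diagonal-pair : ∀ a b → proj₁ (diagonal (pair a b)) ≡ a + b
diagonal-pair a b = onDiagonal-unique (proj₂ (diagonal (pair a b)))
  (m≤m+n (triangle (a + b)) b , +-monoʳ-< (triangle (a + b)) (s≤s (m≤n+m b a)))

unpair₂-pair : ∀ a b → unpair₂ (pair a b) ≡ b
unpair₂-pair a b rewrite diagonal-pair a b = m+n∸m≡n (triangle (a + b)) b

unpair₁-pair : ∀ a b → unpair₁ (pair a b) ≡ a
unpair₁-pair a b rewrite unpair₂-pair a b | diagonal-pair a b = m+n∸n≡m a b

-- The diagonal of q is the least z with q < triangle (suc z), i.e. with 1 + q ∸ triangle (suc z) ≡ 0.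
diagonalTestᶜ : Code 2
diagonalTestᶜ = app₂ monusᶜ (app₁ succ #1) (app₁ triangleᶜ (app₁ succ #0))

eval-diagonalTest : ∀ {g} z q → Eval g diagonalTestᶜ (z ∷ q ∷ []) (suc q ∸ triangle (suc z))
eval-diagonalTest z q =
  eval-app₂ (eval-app₁ ev-proj ev-succ) (eval-app₁ (eval-app₁ ev-proj ev-succ) (eval-triangle (suc z)))
            (eval-monus (suc q) (triangle (suc z)))

diagonalᶜ : Code 1
diagonalᶜ = mu diagonalTestᶜ

eval-diagonal : ∀ {g} q → Eval g diagonalᶜ (q ∷ []) (proj₁ (diagonal q))
eval-diagonal {g} q with diagonal q
... | d , t≤q , q<t = ev-mu (subst (Eval g diagonalTestᶜ (d ∷ q ∷ [])) (m≤n⇒m∸n≡0 q<t) (eval-diagonalTest d q))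
  (λ z z<d → q ∸ triangle (suc z) ,
    subst (Eval g diagonalTestᶜ (z ∷ q ∷ [])) (+-∸-assoc 1 (≤-trans (triangle-mono-≤ z<d) t≤q))
          (eval-diagonalTest z q))

unpair₂ᶜ : Code 1
unpair₂ᶜ = app₂ monusᶜ #0 (app₁ triangleᶜ diagonalᶜ)

eval-unpair₂ : ∀ {g} q → Eval g unpair₂ᶜ (q ∷ []) (unpair₂ q)
eval-unpair₂ q = eval-app₂ ev-proj (eval-app₁ (eval-diagonal q) (eval-triangle _)) (eval-monus q _)

unpair₁ᶜ : Code 1
unpair₁ᶜ = app₂ monusᶜ diagonalᶜ unpair₂ᶜ

eval-unpair₁ : ∀ {g} q → Eval g unpair₁ᶜ (q ∷ []) (unpair₁ q)
eval-unpair₁ q = eval-app₂ (eval-diagonal q) (eval-unpair₂ q) (eval-monus _ (unpair₂ q))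

-- Bounded runs against partial oracles

-- Partial oracles and bounded runs encode "undefined" by 0 and a value v by suc v.
PartialOracle : Set
PartialOracle = ℕ → ℕ

_⊑_ : PartialOracle → PartialOracle → Set
O ⊑ O' = ∀ q v → O q ≡ suc v → O' q ≡ suc v

_approximates_ : PartialOracle → Baire → Set
O approximates G = ∀ q v → O q ≡ suc v → G q ≡ v

-- run O s c xs cuts every μ-search off at s. A μ-search state is 0 while every candidate tested so far was rejected, 1 once a test
-- diverged, and 2 + y once y was found.
searchStep : ℕ → ℕ → ℕ
searchStep r t = ifZero r 1 (ifZero (pred r) (suc (suc t)) 0)

mutual
  run : ∀ {n} → PartialOracle → ℕ → Code n → Vec ℕ n → ℕ
  run O s zer xs = 1
  run O s succ (x ∷ []) = suc (suc x)
  run O s (proj i) xs = suc (lookup xs i)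
  run O s oracle (x ∷ []) = O x
  run O s (comp f hs) xs = ifZero (runAll O s hs xs) 0 (run O s f (runArgs O s hs xs))
  run O s (prec f h) (k ∷ xs) = runRec O s f h k xs
  run O s (mu f) xs = pred (search O s f xs s)

  runAll : ∀ {n m} → PartialOracle → ℕ → Vec (Code n) m → Vec ℕ n → ℕ
  runAll O s [] xs = 1
  runAll O s (h ∷ hs) xs = ifZero (run O s h xs) 0 (runAll O s hs xs)

  runArgs : ∀ {n m} → PartialOracle → ℕ → Vec (Code n) m → Vec ℕ n → Vec ℕ m
  runArgs O s [] xs = []
  runArgs O s (h ∷ hs) xs = pred (run O s h xs) ∷ runArgs O s hs xs

  runRec : ∀ {n} → PartialOracle → ℕ → Code n → Code (suc (suc n)) → ℕ → Vec ℕ n → ℕ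
  runRec O s f h zero xs = run O s f xs
  runRec O s f h (suc j) xs =
    ifZero (runRec O s f h j xs) 0 (run O s h (j ∷ pred (runRec O s f h j xs) ∷ xs))

  search : ∀ {n} → PartialOracle → ℕ → Code (suc n) → Vec ℕ n → ℕ → ℕ
  search O s f xs zero = 0
  search O s f xs (suc t) =
    ifZero (search O s f xs t) (searchStep (run O s f (t ∷ xs)) t) (search O s f xs t)

RejectedBelow : PartialOracle → ℕ → ∀ {n} → Code (suc n) → Vec ℕ n → ℕ → Set
RejectedBelow O s f xs y = ∀ z → z < y → Σ ℕ λ k → run O s f (z ∷ xs) ≡ suc (suc k)

module _ (O : PartialOracle) (s : ℕ) {n} (f : Code (suc n)) (xs : Vec ℕ n) where
  search-≡0 : ∀ t → search O s f xs t ≡ 0 → RejectedBelow O s f xs t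
  search-≡0 (suc t) eq z z<t with search O s f xs t in eq-t
  search-≡0 (suc t) ()  z z<t | suc _
  search-≡0 (suc t) eq  z z<t | zero with run O s f (t ∷ xs) in eq-r
  search-≡0 (suc t) ()  z z<t | zero | zero
  search-≡0 (suc t) ()  z z<t | zero | suc zero
  search-≡0 (suc t) eq  z z<t | zero | suc (suc k) with m<1+n⇒m<n∨m≡n z<t
  ... | inj₁ z<t' = search-≡0 t eq-t z z<t'
  ... | inj₂ refl = k , eq-r

  search-≡2+ : ∀ t y → search O s f xs t ≡ suc (suc y) →
               y < t × run O s f (y ∷ xs) ≡ 1 × RejectedBelow O s f xs y
  search-≡2+ (suc t) y eq with search O s f xs t in eq-t
  search-≡2+ (suc t) y eq | suc _ with search-≡2+ t y (trans eq-t eq)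
  ... | y<t , accepted , rejected = ≤-trans y<t (n≤1+n t) , accepted , rejected
  search-≡2+ (suc t) y eq | zero with run O s f (t ∷ xs) in eq-r
  search-≡2+ (suc t) y () | zero | zero
  search-≡2+ (suc t) y refl | zero | suc zero = ≤-refl , eq-r , search-≡0 t eq-t
  search-≡2+ (suc t) y () | zero | suc (suc k)

  search-rejectedBelow : ∀ {y} → RejectedBelow O s f xs y → ∀ t → t ≤ y → search O s f xs t ≡ 0
  search-rejectedBelow rejected zero t≤y = refl
  search-rejectedBelow rejected (suc t) t<y
    rewrite search-rejectedBelow rejected t (≤-trans (n≤1+n t) t<y) | proj₂ (rejected t t<y) = refl

  search-finds : ∀ {y} → run O s f (y ∷ xs) ≡ 1 → RejectedBelow O s f xs y →
                 ∀ t → y < t → search O s f xs t ≡ suc (suc y)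
  search-finds {y} accepted rejected (suc t) y<1+t with m<1+n⇒m<n∨m≡n y<1+t
  ... | inj₁ y<t rewrite search-finds accepted rejected t y<t = refl
  ... | inj₂ refl rewrite search-rejectedBelow rejected y ≤-refl | accepted = refl

module _ {O : PartialOracle} {G : Baire} (O≼G : O approximates G) (s : ℕ) where
  mutual
    run-sound : ∀ {n} (c : Code n) xs y → run O s c xs ≡ suc y → Eval G c xs y
    run-sound zer xs y refl = ev-zer
    run-sound succ (x ∷ []) y refl = ev-succ
    run-sound (proj i) xs y refl = ev-proj
    run-sound oracle (x ∷ []) y eq = subst (Eval G oracle (x ∷ [])) (O≼G x y eq) ev-oracle
    run-sound (comp f hs) xs y eq with runAll O s hs xs in eq-all
    ... | suc _ = ev-comp (runAll-sound hs xs eq-all) (run-sound f _ y eq)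
    run-sound (prec f h) (k ∷ xs) y eq = runRec-sound f h xs k y eq
    run-sound (mu f) xs y eq with search O s f xs s in eq-search
    run-sound (mu f) xs y refl | suc (suc y) with search-≡2+ O s f xs s y eq-search
    ... | _ , accepted , rejected =
      ev-mu (run-sound f _ 0 accepted)
            (λ z z<y → proj₁ (rejected z z<y) , run-sound f _ _ (proj₂ (rejected z z<y)))

    runAll-sound : ∀ {n m} (hs : Vec (Code n) m) xs {a} → runAll O s hs xs ≡ suc a →
                   EvalVec G hs xs (runArgs O s hs xs)
    runAll-sound [] xs eq = evv-[]
    runAll-sound (h ∷ hs) xs eq with run O s h xs in eq-h
    ... | suc y = evv-∷ (run-sound h xs y eq-h) (runAll-sound hs xs eq)

    runRec-sound : ∀ {n} (f : Code n) h xs k y → runRec O s f h k xs ≡ suc y → Eval G (prec f h) (k ∷ xs) y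
    runRec-sound f h xs zero y eq = ev-prec0 (run-sound f xs y eq)
    runRec-sound f h xs (suc j) y eq with runRec O s f h j xs in eq-j
    ... | suc r = ev-precS (runRec-sound f h xs j r eq-j) (run-sound h _ y eq)

module _ {O O' : PartialOracle} (O⊑O' : O ⊑ O') {s s' : ℕ} (s≤s' : s ≤ s') where
  mutual
    run-mono : ∀ {n} (c : Code n) xs y → run O s c xs ≡ suc y → run O' s' c xs ≡ suc y
    run-mono zer xs y eq = eq
    run-mono succ (x ∷ []) y eq = eq
    run-mono (proj i) xs y eq = eq
    run-mono oracle (x ∷ []) y eq = O⊑O' x y eq
    run-mono (comp f hs) xs y eq with runAll O s hs xs in eq-all
    ... | suc _ with runAll-mono hs xs eq-all
    ... | eq-all' , eq-args rewrite eq-all' | eq-args = run-mono f _ y eq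
    run-mono (prec f h) (k ∷ xs) y eq = runRec-mono f h xs k y eq
    run-mono (mu f) xs y eq with search O s f xs s in eq-search
    run-mono (mu f) xs y refl | suc (suc y) with search-≡2+ O s f xs s y eq-search
    ... | y<s , accepted , rejected
      rewrite search-finds O' s' f xs (run-mono f _ 0 accepted)
                (λ z z<y → proj₁ (rejected z z<y) , run-mono f _ _ (proj₂ (rejected z z<y)))
                s' (≤-trans y<s s≤s') = refl

    runAll-mono : ∀ {n m} (hs : Vec (Code n) m) xs {a} → runAll O s hs xs ≡ suc a →
                  runAll O' s' hs xs ≡ suc a × runArgs O' s' hs xs ≡ runArgs O s hs xs
    runAll-mono [] xs eq = eq , refl
    runAll-mono (h ∷ hs) xs eq with run O s h xs in eq-h
    ... | suc y with runAll-mono hs xs eq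
    ... | eq-all , eq-args rewrite run-mono h xs y eq-h | eq-all | eq-args = refl , refl

    runRec-mono : ∀ {n} (f : Code n) h xs k y → runRec O s f h k xs ≡ suc y → runRec O' s' f h k xs ≡ suc y
    runRec-mono f h xs zero y eq = run-mono f xs y eq
    runRec-mono f h xs (suc j) y eq with runRec O s f h j xs in eq-j
    ... | suc r rewrite runRec-mono f h xs j r eq-j = run-mono h _ y eq

module _ {O : PartialOracle} {s : ℕ} where
  run-comp : ∀ {n m} {f : Code m} {hs : Vec (Code n) m} {xs ys y} → runAll O s hs xs ≡ 1 →
             runArgs O s hs xs ≡ ys → run O s f ys ≡ suc y → run O s (comp f hs) xs ≡ suc y
  run-comp all-defined args f↦y rewrite all-defined | args = f↦y

  runAll-∷ : ∀ {n m} {h : Code n} {hs : Vec (Code n) m} {xs y} → run O s h xs ≡ suc y →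
             runAll O s hs xs ≡ 1 → runAll O s (h ∷ hs) xs ≡ 1
  runAll-∷ h↦y all-defined rewrite h↦y = all-defined

  runRec-suc : ∀ {n} {f : Code n} {h xs j r y} → runRec O s f h j xs ≡ suc r →
               run O s h (j ∷ r ∷ xs) ≡ suc y → runRec O s f h (suc j) xs ≡ suc y
  runRec-suc rec h↦y rewrite rec = h↦y

  rejectedBelow-suc : ∀ {n} {f : Code (suc n)} {xs y k} → RejectedBelow O s f xs y →
                      run O s f (y ∷ xs) ≡ suc (suc k) → RejectedBelow O s f xs (suc y)
  rejectedBelow-suc rejected last z z<1+y with m<1+n⇒m<n∨m≡n z<1+y
  ... | inj₁ z<y = rejected z z<y
  ... | inj₂ refl = _ , last

module _ {G : Baire} (stage : ℕ → PartialOracle) (stage-mono : ∀ {m m'} → m ≤ m' → stage m ⊑ stage m')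
         (stage-converges : ∀ q → Σ ℕ λ m → stage m q ≡ suc (G q)) where

  private
    run-lift : ∀ {n} (c : Code n) {xs y m m'} → m ≤ m' →
               run (stage m) m c xs ≡ suc y → run (stage m') m' c xs ≡ suc y
    run-lift c m≤m' = run-mono (stage-mono m≤m') m≤m' c _ _

    rejectedBelow-lift : ∀ {n} {f : Code (suc n)} {xs y m m'} → m ≤ m' →
                         RejectedBelow (stage m) m f xs y → RejectedBelow (stage m') m' f xs y
    rejectedBelow-lift {f = f} m≤m' rejected z z<y =
      proj₁ (rejected z z<y) , run-lift f m≤m' (proj₂ (rejected z z<y))

  mutual
    run-complete : ∀ {n} {c : Code n} {xs y} → Eval G c xs y → Σ ℕ λ m → run (stage m) m c xs ≡ suc y
    run-complete ev-zer = 0 , refl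
    run-complete ev-succ = 0 , refl
    run-complete ev-proj = 0 , refl
    run-complete (ev-oracle {x}) = stage-converges x
    run-complete (ev-comp {f = f} {hs} args f↦y) with runAll-complete args | run-complete f↦y
    ... | m₁ , all₁ , args₁ | m₂ , f₂ with runAll-mono (stage-mono (m≤m⊔n m₁ m₂)) (m≤m⊔n m₁ m₂) hs _ all₁
    ... | all , args = m₁ ⊔ m₂ , run-comp {f = f} {hs} all (trans args args₁) (run-lift f (m≤n⊔m m₁ m₂) f₂)
    run-complete (ev-prec0 f↦y) = run-complete f↦y
    run-complete (ev-precS {f = f} {h} {xs} {k} rec h↦y) with run-complete rec | run-complete h↦y
    ... | m₁ , rec₁ | m₂ , h₂ =
      m₁ ⊔ m₂ , runRec-suc {f = f} {h} {xs} {k} (run-lift (prec f h) {k ∷ xs} (m≤m⊔n m₁ m₂) rec₁)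
                                                 (run-lift h (m≤n⊔m m₁ m₂) h₂)
    run-complete (ev-mu {f = f} {xs} {y} accepted rejected)
      with run-complete accepted | run-complete-rejectedBelow rejected y ≤-refl
    ... | m₁ , accepted₁ | m₂ , rejected₂ =
      M , cong pred (search-finds (stage M) M f xs
            (run-lift f (≤-trans (m≤m⊔n m₁ m₂) (m≤m⊔n (m₁ ⊔ m₂) (suc y))) accepted₁)
            (rejectedBelow-lift {f = f} (≤-trans (m≤n⊔m m₁ m₂) (m≤m⊔n (m₁ ⊔ m₂) (suc y))) rejected₂)
            M (m≤n⊔m (m₁ ⊔ m₂) (suc y)))
      where M = m₁ ⊔ m₂ ⊔ suc y

    runAll-complete : ∀ {n m} {hs : Vec (Code n) m} {xs ys} → EvalVec G hs xs ys →
                      Σ ℕ λ M → runAll (stage M) M hs xs ≡ 1 × runArgs (stage M) M hs xs ≡ ys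
    runAll-complete evv-[] = 0 , refl , refl
    runAll-complete (evv-∷ {c = h} {hs} h↦y args) with run-complete h↦y | runAll-complete args
    ... | m₁ , h₁ | m₂ , all₂ , args₂ with runAll-mono (stage-mono (m≤n⊔m m₁ m₂)) (m≤n⊔m m₁ m₂) hs _ all₂
    ... | all , args =
      m₁ ⊔ m₂ , runAll-∷ {h = h} {hs} h↦y' all , cong₂ _∷_ (cong pred h↦y') (trans args args₂)
      where h↦y' = run-lift h (m≤m⊔n m₁ m₂) h₁

    run-complete-rejectedBelow : ∀ {n} {f : Code (suc n)} {xs y} →
      (∀ z → z < y → Σ ℕ λ k → Eval G f (z ∷ xs) (suc k)) →
      ∀ y' → y' ≤ y → Σ ℕ λ m → RejectedBelow (stage m) m f xs y'
    run-complete-rejectedBelow rejected zero _ = 0 , λ _ ()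
    run-complete-rejectedBelow {f = f} rejected (suc y') y'<y
      with run-complete-rejectedBelow rejected y' (≤-trans (n≤1+n y') y'<y)
         | run-complete (proj₂ (rejected y' y'<y))
    ... | m₁ , rejected₁ | m₂ , last₂ =
      m₁ ⊔ m₂ , rejectedBelow-suc {f = f} (rejectedBelow-lift {f = f} (m≤m⊔n m₁ m₂) rejected₁)
                                          (run-lift f (m≤n⊔m m₁ m₂) last₂)

evalVec-projections : ∀ {g m n} (ι : Fin m → Fin n) (xs : Vec ℕ n) →
                      EvalVec g (tabulate (λ j → proj (ι j))) xs (tabulate (λ j → lookup xs (ι j)))
evalVec-projections {m = zero} ι xs = evv-[]
evalVec-projections {m = suc m} ι xs = evv-∷ ev-proj (evalVec-projections (λ j → ι (suc j)) xs)

restᶜ : ∀ {n} k → Vec (Code (k + n)) n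
restᶜ k = tabulate (λ j → proj (k ↑ʳ j))

evalVec-rest : ∀ {g k n} (pre : Vec ℕ k) (xs : Vec ℕ n) → EvalVec g (restᶜ k) (pre ++ xs) xs
evalVec-rest {g} {k} pre xs =
  subst (EvalVec g (restᶜ k) (pre ++ xs))
        (trans (tabulate-cong (lookup-++ʳ pre xs)) (tabulate∘lookup xs))
        (evalVec-projections (k ↑ʳ_) (pre ++ xs))

searchStepᶜ : Code 2
searchStepᶜ = app₃ ifZeroᶜ #0 (numeral 1) (app₃ ifZeroᶜ (app₁ predᶜ #0) (app₁ succ (app₁ succ #1)) zer)

eval-searchStep : ∀ {g} r t → Eval g searchStepᶜ (r ∷ t ∷ []) (searchStep r t)
eval-searchStep r t =
  eval-app₃ ev-proj (eval-numeral 1)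
    (eval-app₃ (eval-app₁ ev-proj (eval-pred r)) (eval-app₁ (eval-app₁ ev-proj ev-succ) ev-succ) ev-zer
               (eval-ifZero (pred r) (suc (suc t)) 0))
    (eval-ifZero r 1 _)

-- The compiled codes take the cut-off s and the parameter p of the partial oracle as two extra
-- leading inputs; acc computes the partial oracle with parameter p at the query q from (q, p).
module Compile (acc : Code 2) where
  runRecStepᶜ : ∀ {n} → Code (suc (suc (suc (suc n)))) → Code (suc (suc (suc (suc n))))
  runRecStepᶜ hᶜ = app₃ ifZeroᶜ #1 zer (comp hᶜ (#2 ∷ #3 ∷ #0 ∷ app₁ predᶜ #1 ∷ restᶜ 4))

  searchLoopᶜ : ∀ {n} → Code (suc (suc (suc n))) → Code (suc (suc (suc (suc n))))
  searchLoopᶜ fᶜ = app₃ ifZeroᶜ #1 (app₂ searchStepᶜ (comp fᶜ (#2 ∷ #3 ∷ #0 ∷ restᶜ 4)) #0) #1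

  mutual
    runᶜ : ∀ {n} → Code n → Code (suc (suc n))
    runᶜ zer = numeral 1
    runᶜ succ = app₁ succ (app₁ succ #2)
    runᶜ (proj i) = app₁ succ (proj (suc (suc i)))
    runᶜ oracle = app₂ acc #2 #1
    runᶜ (comp f hs) = app₃ ifZeroᶜ (runAllᶜ hs) zer (comp (runᶜ f) (#0 ∷ #1 ∷ runArgsᶜ hs))
    runᶜ (prec f h) = comp (prec (runᶜ f) (runRecStepᶜ (runᶜ h))) (#2 ∷ #0 ∷ #1 ∷ restᶜ 3)
    runᶜ (mu f) = app₁ predᶜ (comp (prec zer (searchLoopᶜ (runᶜ f))) (#0 ∷ #0 ∷ #1 ∷ restᶜ 2))

    runAllᶜ : ∀ {n m} → Vec (Code n) m → Code (suc (suc n))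
    runAllᶜ [] = numeral 1
    runAllᶜ (h ∷ hs) = app₃ ifZeroᶜ (runᶜ h) zer (runAllᶜ hs)

    runArgsᶜ : ∀ {n m} → Vec (Code n) m → Vec (Code (suc (suc n))) m
    runArgsᶜ [] = []
    runArgsᶜ (h ∷ hs) = app₁ predᶜ (runᶜ h) ∷ runArgsᶜ hs

  module _ {G : Baire} {A : ℕ → PartialOracle} (eval-acc : ∀ q p → Eval G acc (q ∷ p ∷ []) (A p q)) where
    mutual
      eval-runᶜ : ∀ {n} (c : Code n) s p xs → Eval G (runᶜ c) (s ∷ p ∷ xs) (run (A p) s c xs)
      eval-runᶜ zer s p xs = eval-numeral 1
      eval-runᶜ succ s p (x ∷ []) = eval-app₁ (eval-app₁ ev-proj ev-succ) ev-succ
      eval-runᶜ (proj i) s p xs = eval-app₁ ev-proj ev-succ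
      eval-runᶜ oracle s p (x ∷ []) = eval-app₂ ev-proj ev-proj (eval-acc x p)
      eval-runᶜ (comp f hs) s p xs =
        eval-app₃ (eval-runAllᶜ hs s p xs) ev-zer
          (ev-comp (evv-∷ ev-proj (evv-∷ ev-proj (evalVec-runArgsᶜ hs s p xs))) (eval-runᶜ f s p _))
          (eval-ifZero _ 0 _)
      eval-runᶜ (prec f h) s p (k ∷ xs) =
        ev-comp (evv-∷ ev-proj (evv-∷ ev-proj (evv-∷ ev-proj (evalVec-rest (s ∷ p ∷ k ∷ []) xs))))
                (eval-runRecᶜ f h s p xs k)
      eval-runᶜ (mu f) s p xs =
        eval-app₁ (ev-comp (evv-∷ ev-proj (evv-∷ ev-proj (evv-∷ ev-proj (evalVec-rest (s ∷ p ∷ []) xs))))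
                           (eval-searchᶜ f s p xs s))
                  (eval-pred _)

      eval-runAllᶜ : ∀ {n m} (hs : Vec (Code n) m) s p xs → Eval G (runAllᶜ hs) (s ∷ p ∷ xs) (runAll (A p) s hs xs)
      eval-runAllᶜ [] s p xs = eval-numeral 1
      eval-runAllᶜ (h ∷ hs) s p xs = eval-app₃ (eval-runᶜ h s p xs) ev-zer (eval-runAllᶜ hs s p xs) (eval-ifZero _ 0 _)

      evalVec-runArgsᶜ : ∀ {n m} (hs : Vec (Code n) m) s p xs →
                         EvalVec G (runArgsᶜ hs) (s ∷ p ∷ xs) (runArgs (A p) s hs xs)
      evalVec-runArgsᶜ [] s p xs = evv-[]
      evalVec-runArgsᶜ (h ∷ hs) s p xs = evv-∷ (eval-app₁ (eval-runᶜ h s p xs) (eval-pred _)) (evalVec-runArgsᶜ hs s p xs)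

      eval-runRecᶜ : ∀ {n} (f : Code n) h s p xs k →
                     Eval G (prec (runᶜ f) (runRecStepᶜ (runᶜ h))) (k ∷ s ∷ p ∷ xs) (runRec (A p) s f h k xs)
      eval-runRecᶜ f h s p xs zero = ev-prec0 (eval-runᶜ f s p xs)
      eval-runRecᶜ f h s p xs (suc j) = ev-precS (eval-runRecᶜ f h s p xs j)
        (eval-app₃ ev-proj ev-zer
          (ev-comp (evv-∷ ev-proj (evv-∷ ev-proj (evv-∷ ev-proj (evv-∷ (eval-app₁ ev-proj (eval-pred _))
                     (evalVec-rest (j ∷ runRec (A p) s f h j xs ∷ s ∷ p ∷ []) xs)))))
                   (eval-runᶜ h s p _))
          (eval-ifZero _ 0 _))

      eval-searchᶜ : ∀ {n} (f : Code (suc n)) s p xs t →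
                     Eval G (prec zer (searchLoopᶜ (runᶜ f))) (t ∷ s ∷ p ∷ xs) (search (A p) s f xs t)
      eval-searchᶜ f s p xs zero = ev-prec0 ev-zer
      eval-searchᶜ f s p xs (suc t) = ev-precS (eval-searchᶜ f s p xs t)
        (eval-app₃ ev-proj
          (eval-app₂ (ev-comp (evv-∷ ev-proj (evv-∷ ev-proj (evv-∷ ev-proj
                                (evalVec-rest (t ∷ search (A p) s f xs t ∷ s ∷ p ∷ []) xs))))
                              (eval-runᶜ f s p _))
                     ev-proj (eval-searchStep _ t))
          ev-proj (eval-ifZero _ _ _))

-- Functionals on Baire space

tail : Baire → Baire
tail f i = f (suc i)

evens : Baire → Baire
evens f i = f (double i)

odds : Baire → Baire
odds f i = f (suc (double i))

interleave : Baire → Baire → Baire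
interleave g h q = ifZero (parity q) (g (half q)) (h (half q))

evens-interleave : ∀ g h → evens (interleave g h) ≈B g
evens-interleave g h i rewrite parity-double i | half-double i = refl

odds-interleave : ∀ g h → odds (interleave g h) ≈B h
odds-interleave g h i rewrite parity-1+double i | half-1+double i = refl

interleave-congʳ : ∀ g {h h'} → h ≈B h' → interleave g h ≈B interleave g h'
interleave-congʳ g h≈h' q = cong (ifZero (parity q) (g (half q))) (h≈h' (half q))

⌢-congʳ : ∀ n {f f'} → f ≈B f' → (n ⌢ f) ≈B (n ⌢ f')
⌢-congʳ n f≈f' zero = refl
⌢-congʳ n f≈f' (suc x) = f≈f' x

⌢-interleave : ∀ n g h → (n ⌢ interleave g h) ≈B interleave (n ⌢ h) g
⌢-interleave n g h q with evenOdd q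
... | even zero = refl
... | even (suc j) rewrite parity-double (suc j) | half-double (suc j) = odds-interleave g h j
... | odd i rewrite parity-1+double i | half-1+double i = evens-interleave g h i

⟦⟧↦-at : ∀ {Φ G f x k} → Φ ⟦ G ⟧↦ f → f x ≡ k → Eval G Φ (x ∷ []) k
⟦⟧↦-at {Φ} {G} {x = x} Φ↦f refl = Φ↦f x

tailᶜ : Code 1
tailᶜ = app₁ oracle (app₁ succ #0)

tailᶜ-↦ : ∀ {G} → tailᶜ ⟦ G ⟧↦ tail G
tailᶜ-↦ x = eval-app₁ (eval-app₁ ev-proj ev-succ) ev-oracle

evensᶜ : Code 1
evensᶜ = app₁ oracle (app₁ succ (app₁ doubleᶜ #0))

evensᶜ-↦ : ∀ {G} → evensᶜ ⟦ G ⟧↦ evens (tail G)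
evensᶜ-↦ i = eval-app₁ (eval-app₁ (eval-app₁ ev-proj (eval-double i)) ev-succ) ev-oracle

oddsᶜ : Code 1
oddsᶜ = app₁ oracle (app₁ succ (app₁ succ (app₁ doubleᶜ #0)))

oddsᶜ-↦ : ∀ {G} → oddsᶜ ⟦ G ⟧↦ odds (tail G)
oddsᶜ-↦ i = eval-app₁ (eval-app₁ (eval-app₁ (eval-app₁ ev-proj (eval-double i)) ev-succ) ev-succ) ev-oracle

prependᶜ : Code 1 → Code 1 → Code 1
prependᶜ a Φ = app₃ ifZeroᶜ #0 (app₁ a zer) (app₁ Φ (app₁ predᶜ #0))

prependᶜ-↦ : ∀ {G a Φ k f} → Eval G a (0 ∷ []) k → Φ ⟦ G ⟧↦ f → prependᶜ a Φ ⟦ G ⟧↦ (k ⌢ f)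
prependᶜ-↦ a↦k Φ↦f zero =
  eval-app₃ ev-proj (eval-app₁ ev-zer a↦k) (eval-app₁ (eval-app₁ ev-proj (eval-pred 0)) (Φ↦f 0)) (eval-ifZero 0 _ _)
prependᶜ-↦ a↦k Φ↦f (suc x) =
  eval-app₃ ev-proj (eval-app₁ ev-zer a↦k) (eval-app₁ (eval-app₁ ev-proj (eval-pred (suc x))) (Φ↦f x))
            (eval-ifZero (suc x) _ _)

interleaveᶜ : Code 1 → Code 1 → Code 1
interleaveᶜ Φ Ψ = app₃ ifZeroᶜ (app₁ parityᶜ #0) (app₁ Φ (app₁ halfᶜ #0)) (app₁ Ψ (app₁ halfᶜ #0))

interleaveᶜ-↦ : ∀ {G Φ Ψ g h} → Φ ⟦ G ⟧↦ g → Ψ ⟦ G ⟧↦ h → interleaveᶜ Φ Ψ ⟦ G ⟧↦ interleave g h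
interleaveᶜ-↦ Φ↦g Ψ↦h q =
  eval-app₃ (eval-app₁ ev-proj (eval-parity q)) (eval-app₁ (eval-app₁ ev-proj (eval-half q)) (Φ↦g (half q)))
            (eval-app₁ (eval-app₁ ev-proj (eval-half q)) (Ψ↦h (half q))) (eval-ifZero (parity q) _ _)

-- Codes evaluate all arguments, so a case distinction must hide its branches in the step of a
-- primitive recursion: guardᶜ c runs c only when its first input is positive.
guardᶜ : Code 1 → Code 2
guardᶜ c = prec zer (app₁ c #2)

eval-guard-zero : ∀ {G c q} → Eval G (guardᶜ c) (0 ∷ q ∷ []) 0
eval-guard-zero = ev-prec0 ev-zer

eval-guard-suc : ∀ {G c q v} b → Eval G c (q ∷ []) v → Eval G (guardᶜ c) (suc b ∷ q ∷ []) v
eval-guard-suc zero c↦v = ev-precS eval-guard-zero (eval-app₁ ev-proj c↦v)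
eval-guard-suc (suc b) c↦v = ev-precS (eval-guard-suc b c↦v) (eval-app₁ ev-proj c↦v)

branchᶜ : Code 1 → Code 1 → Code 1 → Code 1
branchᶜ t Φ Ψ = app₂ addᶜ (app₂ (guardᶜ Φ) (app₁ isZeroᶜ (app₁ t zer)) #0) (app₂ (guardᶜ Ψ) (app₁ t zer) #0)

branchᶜ-zero : ∀ {G t Φ Ψ f} → Eval G t (0 ∷ []) 0 → Φ ⟦ G ⟧↦ f → branchᶜ t Φ Ψ ⟦ G ⟧↦ f
branchᶜ-zero {G} {f = f} t↦0 Φ↦f x = subst (Eval G _ (x ∷ [])) (+-identityʳ (f x))
  (eval-app₂ (eval-app₂ (eval-app₁ (eval-app₁ ev-zer t↦0) (eval-isZero 0)) ev-proj (eval-guard-suc 0 (Φ↦f x)))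
             (eval-app₂ (eval-app₁ ev-zer t↦0) ev-proj eval-guard-zero)
             (eval-add (f x) 0))

branchᶜ-suc : ∀ {G t Φ Ψ h k} → Eval G t (0 ∷ []) (suc k) → Ψ ⟦ G ⟧↦ h → branchᶜ t Φ Ψ ⟦ G ⟧↦ h
branchᶜ-suc {k = k} t↦k Ψ↦h x =
  eval-app₂ (eval-app₂ (eval-app₁ (eval-app₁ ev-zer t↦k) (eval-isZero (suc k))) ev-proj eval-guard-zero)
            (eval-app₂ (eval-app₁ ev-zer t↦k) ev-proj (eval-guard-suc k (Ψ↦h x)))
            (eval-add 0 _)

dropSecondᶜ : Code 1
dropSecondᶜ = prependᶜ oracle (tailᶜ [oracle≔ tailᶜ ])

dropSecondᶜ-↦ : ∀ {n F} → dropSecondᶜ ⟦ n ⌢ F ⟧↦ (n ⌢ tail F)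
dropSecondᶜ-↦ = prependᶜ-↦ ev-oracle (⟦⟧↦-compose tailᶜ-↦ tailᶜ-↦)

-- The lattice of ω-mass problems

Reduction : TuringFunctional → ωMassProblem → ωMassProblem → Set
Reduction Φ 𝒜 ℬ = ∀ n f → ℬ n ∋ f → Σ Baire λ h → (Φ ⟦ n ⌢ f ⟧↦ h) × (𝒜 n ∋ h)

reduction⇒≤Mω : ∀ 𝒜 ℬ Φ → Reduction Φ 𝒜 ℬ → 𝒜 ≤Mω ℬ
reduction⇒≤Mω 𝒜 ℬ Φ reduce = Φ , reduce-≈B
  where
  reduce-≈B : ∀ n g → (Σ Baire λ f → (ℬ n ∋ f) × (g ≈B (n ⌢ f))) → Σ Baire λ h → (Φ ⟦ g ⟧↦ h) × (𝒜 n ∋ h)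
  reduce-≈B n g (f , f∈ , g≈n⌢f) with reduce n f f∈
  ... | h , Φ↦h , h∈ = h , (λ x → eval-resp-≈B (λ q → sym (g≈n⌢f q)) (Φ↦h x)) , h∈

≤Mω⇒reduction : ∀ 𝒜 ℬ (r : 𝒜 ≤Mω ℬ) → Reduction (proj₁ r) 𝒜 ℬ
≤Mω⇒reduction 𝒜 ℬ (Φ , reduce) n f f∈ = reduce n (n ⌢ f) (f , f∈ , λ _ → refl)

𝟎ᴹ : ωMassProblem
𝟎ᴹ n = record { _∋_ = λ _ → ⊤ ; ext = λ _ _ → tt }

𝟏ᴹ : ωMassProblem
𝟏ᴹ n = record { _∋_ = λ _ → ⊥ ; ext = λ _ () }

_⊕ᴹ_ : ωMassProblem → ωMassProblem → ωMassProblem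
(𝒜 ⊕ᴹ ℬ) n = record
  { _∋_ = λ F → (𝒜 n ∋ evens F) × (ℬ n ∋ odds F)
  ; ext = λ F≈F' (F∈₁ , F∈₂) → ext (𝒜 n) (λ i → F≈F' (double i)) F∈₁ , ext (ℬ n) (λ i → F≈F' (suc (double i))) F∈₂
  }

_⊗ᴹ_ : ωMassProblem → ωMassProblem → ωMassProblem
(𝒜 ⊗ᴹ ℬ) n = record
  { _∋_ = λ F → (F 0 ≡ 0 × 𝒜 n ∋ tail F) ⊎ (F 0 ≡ 1 × ℬ n ∋ tail F)
  ; ext = λ { F≈F' (inj₁ (tag , F∈)) → inj₁ (trans (sym (F≈F' 0)) tag , ext (𝒜 n) (λ i → F≈F' (suc i)) F∈)
            ; F≈F' (inj₂ (tag , F∈)) → inj₂ (trans (sym (F≈F' 0)) tag , ext (ℬ n) (λ i → F≈F' (suc i)) F∈) }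
  }

interleave-∈-⊕ᴹ : ∀ 𝒜 ℬ {n g h} → 𝒜 n ∋ g → ℬ n ∋ h → (𝒜 ⊕ᴹ ℬ) n ∋ interleave g h
interleave-∈-⊕ᴹ 𝒜 ℬ {n} {g} {h} g∈ h∈ =
  ext (𝒜 n) (λ i → sym (evens-interleave g h i)) g∈ , ext (ℬ n) (λ i → sym (odds-interleave g h i)) h∈

≤Mω-refl : ∀ {𝒜} → 𝒜 ≤Mω 𝒜
≤Mω-refl {𝒜} = reduction⇒≤Mω 𝒜 𝒜 tailᶜ (λ n f f∈ → f , tailᶜ-↦ , f∈)

≤Mω-trans : ∀ {𝒜 ℬ 𝒞} → 𝒜 ≤Mω ℬ → ℬ ≤Mω 𝒞 → 𝒜 ≤Mω 𝒞
≤Mω-trans {𝒜} {ℬ} {𝒞} 𝒜≤ℬ ℬ≤𝒞 = reduction⇒≤Mω 𝒜 𝒞 _ reduce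
  where
  reduce : Reduction (proj₁ 𝒜≤ℬ [oracle≔ prependᶜ oracle (proj₁ ℬ≤𝒞) ]) 𝒜 𝒞
  reduce n f f∈ with ≤Mω⇒reduction ℬ 𝒞 ℬ≤𝒞 n f f∈
  ... | g , Ψ↦g , g∈ with ≤Mω⇒reduction 𝒜 ℬ 𝒜≤ℬ n g g∈
  ... | h , Φ↦h , h∈ = h , ⟦⟧↦-compose (prependᶜ-↦ ev-oracle Ψ↦g) Φ↦h , h∈

𝟎ᴹ-least : ∀ 𝒜 → 𝟎ᴹ ≤Mω 𝒜
𝟎ᴹ-least 𝒜 = reduction⇒≤Mω 𝟎ᴹ 𝒜 zer (λ n f f∈ → (λ _ → 0) , (λ _ → ev-zer) , tt)

𝟏ᴹ-greatest : ∀ 𝒜 → 𝒜 ≤Mω 𝟏ᴹ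
𝟏ᴹ-greatest 𝒜 = reduction⇒≤Mω 𝒜 𝟏ᴹ zer (λ n f ())

⊕ᴹ-upperˡ : ∀ 𝒜 ℬ → 𝒜 ≤Mω (𝒜 ⊕ᴹ ℬ)
⊕ᴹ-upperˡ 𝒜 ℬ = reduction⇒≤Mω 𝒜 (𝒜 ⊕ᴹ ℬ) evensᶜ (λ n F F∈ → evens F , evensᶜ-↦ , proj₁ F∈)

⊕ᴹ-upperʳ : ∀ 𝒜 ℬ → ℬ ≤Mω (𝒜 ⊕ᴹ ℬ)
⊕ᴹ-upperʳ 𝒜 ℬ = reduction⇒≤Mω ℬ (𝒜 ⊕ᴹ ℬ) oddsᶜ (λ n F F∈ → odds F , oddsᶜ-↦ , proj₂ F∈)

⊕ᴹ-least : ∀ 𝒜 ℬ 𝒞 → 𝒜 ≤Mω 𝒞 → ℬ ≤Mω 𝒞 → (𝒜 ⊕ᴹ ℬ) ≤Mω 𝒞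
⊕ᴹ-least 𝒜 ℬ 𝒞 𝒜≤𝒞 ℬ≤𝒞 = reduction⇒≤Mω (𝒜 ⊕ᴹ ℬ) 𝒞 _ reduce
  where
  reduce : Reduction (interleaveᶜ (proj₁ 𝒜≤𝒞) (proj₁ ℬ≤𝒞)) (𝒜 ⊕ᴹ ℬ) 𝒞
  reduce n f f∈ with ≤Mω⇒reduction 𝒜 𝒞 𝒜≤𝒞 n f f∈ | ≤Mω⇒reduction ℬ 𝒞 ℬ≤𝒞 n f f∈
  ... | g , Φ↦g , g∈ | h , Ψ↦h , h∈ =
    interleave g h , interleaveᶜ-↦ Φ↦g Ψ↦h , interleave-∈-⊕ᴹ 𝒜 ℬ g∈ h∈

⊗ᴹ-lowerˡ : ∀ 𝒜 ℬ → (𝒜 ⊗ᴹ ℬ) ≤Mω 𝒜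
⊗ᴹ-lowerˡ 𝒜 ℬ = reduction⇒≤Mω (𝒜 ⊗ᴹ ℬ) 𝒜 (prependᶜ (numeral 0) tailᶜ)
  (λ n f f∈ → 0 ⌢ f , prependᶜ-↦ (eval-numeral 0) tailᶜ-↦ , inj₁ (refl , f∈))

⊗ᴹ-lowerʳ : ∀ 𝒜 ℬ → (𝒜 ⊗ᴹ ℬ) ≤Mω ℬ
⊗ᴹ-lowerʳ 𝒜 ℬ = reduction⇒≤Mω (𝒜 ⊗ᴹ ℬ) ℬ (prependᶜ (numeral 1) tailᶜ)
  (λ n f f∈ → 1 ⌢ f , prependᶜ-↦ (eval-numeral 1) tailᶜ-↦ , inj₂ (refl , f∈))

⊗ᴹ-greatest : ∀ 𝒜 ℬ 𝒞 → 𝒞 ≤Mω 𝒜 → 𝒞 ≤Mω ℬ → 𝒞 ≤Mω (𝒜 ⊗ᴹ ℬ)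
⊗ᴹ-greatest 𝒜 ℬ 𝒞 𝒞≤𝒜 𝒞≤ℬ = reduction⇒≤Mω 𝒞 (𝒜 ⊗ᴹ ℬ) _ reduce
  where
  reduce : Reduction (branchᶜ tailᶜ (proj₁ 𝒞≤𝒜 [oracle≔ dropSecondᶜ ]) (proj₁ 𝒞≤ℬ [oracle≔ dropSecondᶜ ]))
                     𝒞 (𝒜 ⊗ᴹ ℬ)
  reduce n F (inj₁ (tag , F∈)) with ≤Mω⇒reduction 𝒞 𝒜 𝒞≤𝒜 n (tail F) F∈
  ... | h , Φ↦h , h∈ = h , branchᶜ-zero (⟦⟧↦-at tailᶜ-↦ tag) (⟦⟧↦-compose dropSecondᶜ-↦ Φ↦h) , h∈
  reduce n F (inj₂ (tag , F∈)) with ≤Mω⇒reduction 𝒞 ℬ 𝒞≤ℬ n (tail F) F∈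
  ... | h , Ψ↦h , h∈ = h , branchᶜ-suc (⟦⟧↦-at tailᶜ-↦ tag) (⟦⟧↦-compose dropSecondᶜ-↦ Ψ↦h) , h∈

⊗ᴹ-distrib-⊕ᴹ : ∀ 𝒜 ℬ 𝒞 → (𝒜 ⊗ᴹ (ℬ ⊕ᴹ 𝒞)) ≤Mω ((𝒜 ⊗ᴹ ℬ) ⊕ᴹ (𝒜 ⊗ᴹ 𝒞))
⊗ᴹ-distrib-⊕ᴹ 𝒜 ℬ 𝒞 = reduction⇒≤Mω (𝒜 ⊗ᴹ (ℬ ⊕ᴹ 𝒞)) ((𝒜 ⊗ᴹ ℬ) ⊕ᴹ (𝒜 ⊗ᴹ 𝒞)) _ reduce
  where
  tailEvensᶜ tailOddsᶜ : Code 1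
  tailEvensᶜ = tailᶜ [oracle≔ evensᶜ ]
  tailOddsᶜ = tailᶜ [oracle≔ oddsᶜ ]

  reduce : Reduction (branchᶜ tailᶜ (prependᶜ (numeral 0) tailEvensᶜ)
                       (branchᶜ oddsᶜ (prependᶜ (numeral 0) tailOddsᶜ)
                                      (prependᶜ (numeral 1) (interleaveᶜ tailEvensᶜ tailOddsᶜ))))
                     (𝒜 ⊗ᴹ (ℬ ⊕ᴹ 𝒞)) ((𝒜 ⊗ᴹ ℬ) ⊕ᴹ (𝒜 ⊗ᴹ 𝒞))
  reduce n F (inj₁ (tag , F∈) , _) =
    0 ⌢ tail (evens F) ,
    branchᶜ-zero (⟦⟧↦-at tailᶜ-↦ tag) (prependᶜ-↦ (eval-numeral 0) (⟦⟧↦-compose evensᶜ-↦ tailᶜ-↦)) ,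
    inj₁ (refl , F∈)
  reduce n F (inj₂ (tag , _) , inj₁ (tag' , F∈)) =
    0 ⌢ tail (odds F) ,
    branchᶜ-suc (⟦⟧↦-at tailᶜ-↦ tag)
      (branchᶜ-zero (⟦⟧↦-at oddsᶜ-↦ tag') (prependᶜ-↦ (eval-numeral 0) (⟦⟧↦-compose oddsᶜ-↦ tailᶜ-↦))) ,
    inj₁ (refl , F∈)
  reduce n F (inj₂ (tag , F∈) , inj₂ (tag' , F∈')) =
    1 ⌢ interleave (tail (evens F)) (tail (odds F)) ,
    branchᶜ-suc (⟦⟧↦-at tailᶜ-↦ tag)
      (branchᶜ-suc (⟦⟧↦-at oddsᶜ-↦ tag')
        (prependᶜ-↦ (eval-numeral 1)
          (interleaveᶜ-↦ (⟦⟧↦-compose evensᶜ-↦ tailᶜ-↦) (⟦⟧↦-compose oddsᶜ-↦ tailᶜ-↦)))) ,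
    inj₂ (refl , interleave-∈-⊕ᴹ ℬ 𝒞 F∈ F∈')

-- Implication

prefixCode : Baire → ℕ → ℕ
prefixCode g zero = 0
prefixCode g (suc k) = pair (prefixCode g k) (g k)

prefixCode-cong : ∀ {g g'} → g ≈B g' → ∀ k → prefixCode g k ≡ prefixCode g' k
prefixCode-cong g≈g' zero = refl
prefixCode-cong g≈g' (suc k) = cong₂ pair (prefixCode-cong g≈g' k) (g≈g' k)

prefixCodeᶜ : Code 1
prefixCodeᶜ = prec zer (app₂ pairᶜ #1 (app₁ evensᶜ #0))

prefixCodeᶜ-↦ : ∀ {G} → prefixCodeᶜ ⟦ G ⟧↦ prefixCode (evens (tail G))
prefixCodeᶜ-↦ zero = ev-prec0 ev-zer
prefixCodeᶜ-↦ (suc k) =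
  ev-precS (prefixCodeᶜ-↦ k) (eval-app₂ ev-proj (eval-app₁ ev-proj (evensᶜ-↦ k)) (eval-pair _ _))

fold-unpair₁-prefixCode : ∀ g t r → fold (prefixCode g (t + r)) unpair₁ t ≡ prefixCode g r
fold-unpair₁-prefixCode g zero r = refl
fold-unpair₁-prefixCode g (suc t) r = begin
  unpair₁ (fold (prefixCode g (suc (t + r))) unpair₁ t)
    ≡⟨ cong (λ k → unpair₁ (fold (prefixCode g k) unpair₁ t)) (sym (+-suc t r)) ⟩
  unpair₁ (fold (prefixCode g (t + suc r)) unpair₁ t)
    ≡⟨ cong unpair₁ (fold-unpair₁-prefixCode g t (suc r)) ⟩
  unpair₁ (pair (prefixCode g r) (g r))
    ≡⟨ unpair₁-pair (prefixCode g r) (g r) ⟩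
  prefixCode g r ∎
  where open ≡-Reasoning

foldUnpair₁ᶜ : Code 2
foldUnpair₁ᶜ = prec #0 (app₁ unpair₁ᶜ #1)

eval-foldUnpair₁ : ∀ {G} t c → Eval G foldUnpair₁ᶜ (t ∷ c ∷ []) (fold c unpair₁ t)
eval-foldUnpair₁ zero c = ev-prec0 ev-proj
eval-foldUnpair₁ (suc t) c = ev-precS (eval-foldUnpair₁ t c) (eval-app₁ ev-proj (eval-unpair₁ _))

-- For p = pair m (prefixCode g m), the partial function i ↦ g i restricted to i < m.
lookupPrefix : ℕ → ℕ → ℕ
lookupPrefix p i = ifZero (unpair₁ p ∸ i) 0 (suc (unpair₂ (fold (unpair₂ p) unpair₁ (unpair₁ p ∸ suc i))))

lookupPrefixᶜ : Code 2
lookupPrefixᶜ =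
  app₃ ifZeroᶜ (app₂ monusᶜ (app₁ unpair₁ᶜ #1) #0) zer
    (app₁ succ (app₁ unpair₂ᶜ (app₂ foldUnpair₁ᶜ (app₂ monusᶜ (app₁ unpair₁ᶜ #1) (app₁ succ #0)) (app₁ unpair₂ᶜ #1))))

eval-lookupPrefix : ∀ {G} i p → Eval G lookupPrefixᶜ (i ∷ p ∷ []) (lookupPrefix p i)
eval-lookupPrefix i p =
  eval-app₃ (eval-app₂ (eval-app₁ ev-proj (eval-unpair₁ p)) ev-proj (eval-monus _ i)) ev-zer
    (eval-app₁ (eval-app₁ (eval-app₂ (eval-app₂ (eval-app₁ ev-proj (eval-unpair₁ p)) (eval-app₁ ev-proj ev-succ)
                                                (eval-monus _ (suc i)))
                                     (eval-app₁ ev-proj (eval-unpair₂ p)) (eval-foldUnpair₁ _ _))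
                          (eval-unpair₂ _))
               ev-succ)
    (eval-ifZero _ 0 _)

lookupPrefix-< : ∀ g {m i} → i < m → lookupPrefix (pair m (prefixCode g m)) i ≡ suc (g i)
lookupPrefix-< g {m} {i} i<m
  rewrite unpair₁-pair m (prefixCode g m) | unpair₂-pair m (prefixCode g m) | +-∸-assoc 1 i<m =
  cong suc (begin
    unpair₂ (fold (prefixCode g m) unpair₁ (m ∸ suc i))
      ≡⟨ cong (λ k → unpair₂ (fold (prefixCode g k) unpair₁ (m ∸ suc i))) (sym (m∸n+n≡m i<m)) ⟩
    unpair₂ (fold (prefixCode g (m ∸ suc i + suc i)) unpair₁ (m ∸ suc i))
      ≡⟨ cong unpair₂ (fold-unpair₁-prefixCode g (m ∸ suc i) (suc i)) ⟩
    unpair₂ (pair (prefixCode g i) (g i))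
      ≡⟨ unpair₂-pair (prefixCode g i) (g i) ⟩
    g i ∎)
  where open ≡-Reasoning

lookupPrefix-≥ : ∀ g {m i} → m ≤ i → lookupPrefix (pair m (prefixCode g m)) i ≡ 0
lookupPrefix-≥ g {m} m≤i rewrite unpair₁-pair m (prefixCode g m) | m≤n⇒m∸n≡0 m≤i = refl

stageOracle : Baire → ℕ → PartialOracle
stageOracle O p q = ifZero (parity q) (suc (O (half q))) (lookupPrefix p (half q))

stageOracleᶜ : Code 2
stageOracleᶜ =
  app₃ ifZeroᶜ (app₁ parityᶜ #0) (app₁ succ (app₁ oracle (app₁ halfᶜ #0))) (app₂ lookupPrefixᶜ (app₁ halfᶜ #0) #1)

eval-stageOracle : ∀ {O} q p → Eval O stageOracleᶜ (q ∷ p ∷ []) (stageOracle O p q)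
eval-stageOracle q p =
  eval-app₃ (eval-app₁ ev-proj (eval-parity q)) (eval-app₁ (eval-app₁ (eval-app₁ ev-proj (eval-half q)) ev-oracle) ev-succ)
            (eval-app₂ (eval-app₁ ev-proj (eval-half q)) ev-proj (eval-lookupPrefix (half q) p))
            (eval-ifZero (parity q) _ _)

-- The part of interleave O g that is known from O and the first m values of g.
stage : Baire → Baire → ℕ → PartialOracle
stage O g m = stageOracle O (pair m (prefixCode g m))

module _ (O g : Baire) where
  stage-even : ∀ m j → stage O g m (double j) ≡ suc (O j)
  stage-even m j rewrite parity-double j | half-double j = refl

  stage-odd-< : ∀ {m i} → i < m → stage O g m (suc (double i)) ≡ suc (g i)
  stage-odd-< {i = i} i<m rewrite parity-1+double i | half-1+double i = lookupPrefix-< g i<m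

  stage-odd-≥ : ∀ {m i} → m ≤ i → stage O g m (suc (double i)) ≡ 0
  stage-odd-≥ {i = i} m≤i rewrite parity-1+double i | half-1+double i = lookupPrefix-≥ g m≤i

  stage-mono : ∀ {m m'} → m ≤ m' → stage O g m ⊑ stage O g m'
  stage-mono {m} {m'} m≤m' q v eq with evenOdd q
  ... | even j = trans (stage-even m' j) (trans (sym (stage-even m j)) eq)
  ... | odd i with i <? m
  ...   | yes i<m = trans (stage-odd-< (≤-trans i<m m≤m')) (trans (sym (stage-odd-< i<m)) eq)
  ...   | no i≮m = contradiction (trans (sym (stage-odd-≥ (≮⇒≥ i≮m))) eq) 0≢1+n

  stage-converges : ∀ q → Σ ℕ λ m → stage O g m q ≡ suc (interleave O g q)
  stage-converges q with evenOdd q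
  ... | even j = 0 , trans (stage-even 0 j) (cong suc (sym (evens-interleave O g j)))
  ... | odd i = suc i , trans (stage-odd-< ≤-refl) (cong suc (sym (odds-interleave O g i)))

  stage-approximates : ∀ m → stage O g m approximates interleave O g
  stage-approximates m q v eq with evenOdd q
  ... | even j = trans (evens-interleave O g j) (suc-injective (trans (sym (stage-even m j)) eq))
  ... | odd i with i <? m
  ...   | yes i<m = trans (odds-interleave O g i) (suc-injective (trans (sym (stage-odd-< i<m)) eq))
  ...   | no i≮m = contradiction (trans (sym (stage-odd-≥ (≮⇒≥ i≮m))) eq) 0≢1+n

table : Baire → Code 1 → Baire
table O Ψ q = run (stageOracle O (unpair₂ q)) (unpair₁ (unpair₂ q)) Ψ (unpair₁ q ∷ [])

tableᶜ : Code 1 → Code 1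
tableᶜ Ψ = comp (Compile.runᶜ stageOracleᶜ Ψ)
                (app₁ unpair₁ᶜ (app₁ unpair₂ᶜ #0) ∷ app₁ unpair₂ᶜ #0 ∷ app₁ unpair₁ᶜ #0 ∷ [])

tableᶜ-↦ : ∀ {O} Ψ → tableᶜ Ψ ⟦ O ⟧↦ table O Ψ
tableᶜ-↦ Ψ q =
  ev-comp (evv-∷ (eval-app₁ (eval-app₁ ev-proj (eval-unpair₂ q)) (eval-unpair₁ _))
          (evv-∷ (eval-app₁ ev-proj (eval-unpair₂ q)) (evv-∷ (eval-app₁ ev-proj (eval-unpair₁ q)) evv-[])))
          (Compile.eval-runᶜ stageOracleᶜ eval-stageOracle Ψ _ _ _)

table-stage : ∀ O g Ψ x m → table O Ψ (pair x (pair m (prefixCode g m))) ≡ run (stage O g m) m Ψ (x ∷ [])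
table-stage O g Ψ x m = trans
  (cong₂ (λ p x' → run (stageOracle O p) (unpair₁ p) Ψ (x' ∷ [])) (unpair₂-pair x σ) (unpair₁-pair x σ))
  (cong (λ s → run (stage O g m) s Ψ (x ∷ [])) (unpair₁-pair m (prefixCode g m)))
  where σ = pair m (prefixCode g m)

-- For G = n ⌢ interleave g h, the entry of the table h for the initial segment of g of length m.
entry : Baire → ℕ → ℕ → ℕ
entry G x m = odds (tail G) (pair x (pair m (prefixCode (evens (tail G)) m)))

entryᶜ : Code 2
entryᶜ = app₁ oddsᶜ (app₂ pairᶜ #1 (app₂ pairᶜ #0 (app₁ prefixCodeᶜ #0)))

eval-entry : ∀ {G} m x → Eval G entryᶜ (m ∷ x ∷ []) (entry G x m)
eval-entry m x =
  eval-app₁ (eval-app₂ ev-proj (eval-app₂ ev-proj (eval-app₁ ev-proj (prefixCodeᶜ-↦ m)) (eval-pair m _)) (eval-pair x _))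
            (oddsᶜ-↦ _)

decoderᶜ : Code 1
decoderᶜ = app₁ predᶜ (app₂ entryᶜ (mu (app₁ isZeroᶜ entryᶜ)) #0)

decoderᶜ-first : ∀ {G} x {m y} → entry G x m ≡ suc y → (∀ z → z < m → entry G x z ≡ 0) →
                 Eval G decoderᶜ (x ∷ []) y
decoderᶜ-first {G} x {m} entry≡1+y undefined-below =
  subst (Eval G decoderᶜ (x ∷ [])) (cong pred entry≡1+y)
    (eval-app₁ (eval-app₂ (ev-mu (test entry≡1+y) (λ z z<m → 0 , test (undefined-below z z<m))) ev-proj (eval-entry m x))
               (eval-pred _))
  where
  test : ∀ {z v} → entry G x z ≡ v → Eval G (app₁ isZeroᶜ entryᶜ) (z ∷ x ∷ []) (isZero v)
  test {z} refl = eval-app₁ (eval-entry z x) (eval-isZero _)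

least-defined : (V : ℕ → ℕ) (m₀ : ℕ) {y₀ : ℕ} → V m₀ ≡ suc y₀ →
                Σ ℕ λ m → Σ ℕ λ y → V m ≡ suc y × (∀ z → z < m → V z ≡ 0)
least-defined V zero eq = 0 , _ , eq , λ _ ()
least-defined V (suc m₀) eq with V 0 in eq₀
... | suc y = 0 , y , eq₀ , λ _ ()
... | zero with least-defined (λ i → V (suc i)) m₀ eq
...   | m , y , eq-m , below = suc m , y , eq-m , λ { zero _ → eq₀ ; (suc z) (s≤s z<m) → below z z<m }

-- The decoder recovers Ψ (interleave O g) from g and the table of Ψ over O: the first stage at
-- which the table has an entry exists by completeness and gives the right value by soundness.
decoderᶜ-table : ∀ {Ψ O g H} → Ψ ⟦ interleave O g ⟧↦ H → ∀ n → decoderᶜ ⟦ n ⌢ interleave g (table O Ψ) ⟧↦ H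
decoderᶜ-table {Ψ} {O} {g} {H} Ψ↦H n x
  with run-complete (stage O g) (stage-mono O g) (stage-converges O g) (Ψ↦H x)
... | m₀ , defined with least-defined (λ m → run (stage O g m) m Ψ (x ∷ [])) m₀ defined
...   | m , y , first , undefined-below =
  subst (Eval _ decoderᶜ (x ∷ [])) y≡Hx
    (decoderᶜ-first x (trans (entry-stage m) first) (λ z z<m → trans (entry-stage z) (undefined-below z z<m)))
  where
  entry-stage : ∀ m → entry (n ⌢ interleave g (table O Ψ)) x m ≡ run (stage O g m) m Ψ (x ∷ [])
  entry-stage m = begin
    odds (interleave g (table O Ψ)) (pair x (pair m (prefixCode (evens (interleave g (table O Ψ))) m)))
      ≡⟨ odds-interleave g (table O Ψ) (pair x (pair m (prefixCode (evens (interleave g (table O Ψ))) m))) ⟩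
    table O Ψ (pair x (pair m (prefixCode (evens (interleave g (table O Ψ))) m)))
      ≡⟨ cong (λ σ → table O Ψ (pair x (pair m σ))) (prefixCode-cong (evens-interleave g (table O Ψ)) m) ⟩
    table O Ψ (pair x (pair m (prefixCode g m)))
      ≡⟨ table-stage O g Ψ x m ⟩
    run (stage O g m) m Ψ (x ∷ []) ∎
    where open ≡-Reasoning

  y≡Hx : y ≡ H x
  y≡Hx = eval-deterministic (run-sound (stage-approximates O g m) m Ψ _ y first) (Ψ↦H x)

_⇒ᴹ_ : ωMassProblem → ωMassProblem → ωMassProblem
(𝒜 ⇒ᴹ 𝒞) n = record
  { _∋_ = λ h → ∀ g → 𝒜 n ∋ g → Σ Baire λ H → (decoderᶜ ⟦ n ⌢ interleave g h ⟧↦ H) × (𝒞 n ∋ H)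
  ; ext = λ h≈h' h∈ g g∈ → let (H , decoder↦H , H∈) = h∈ g g∈ in
      H , (λ x → eval-resp-≈B (⌢-congʳ n (interleave-congʳ g h≈h')) (decoder↦H x)) , H∈
  }

table-∈-⇒ᴹ : ∀ 𝒜 ℬ 𝒞 (𝒞≤𝒜⊕ℬ : 𝒞 ≤Mω (𝒜 ⊕ᴹ ℬ)) n h → ℬ n ∋ h →
             (𝒜 ⇒ᴹ 𝒞) n ∋ table (n ⌢ h) (proj₁ 𝒞≤𝒜⊕ℬ)
table-∈-⇒ᴹ 𝒜 ℬ 𝒞 𝒞≤𝒜⊕ℬ n h h∈ g g∈
  with ≤Mω⇒reduction 𝒞 (𝒜 ⊕ᴹ ℬ) 𝒞≤𝒜⊕ℬ n (interleave g h) (interleave-∈-⊕ᴹ 𝒜 ℬ g∈ h∈)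
... | H , Ψ↦H , H∈ = H , decoderᶜ-table {O = n ⌢ h} {g} (λ x → eval-resp-≈B (⌢-interleave n g h) (Ψ↦H x)) n , H∈

⇒ᴹ-adjointʳ : ∀ 𝒜 ℬ 𝒞 → 𝒞 ≤Mω (𝒜 ⊕ᴹ ℬ) → (𝒜 ⇒ᴹ 𝒞) ≤Mω ℬ
⇒ᴹ-adjointʳ 𝒜 ℬ 𝒞 𝒞≤𝒜⊕ℬ = reduction⇒≤Mω (𝒜 ⇒ᴹ 𝒞) ℬ (tableᶜ Ψ)
  (λ n h h∈ → table (n ⌢ h) Ψ , tableᶜ-↦ Ψ , table-∈-⇒ᴹ 𝒜 ℬ 𝒞 𝒞≤𝒜⊕ℬ n h h∈)
  where Ψ = proj₁ 𝒞≤𝒜⊕ℬ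

⇒ᴹ-adjointˡ : ∀ 𝒜 ℬ 𝒞 → (𝒜 ⇒ᴹ 𝒞) ≤Mω ℬ → 𝒞 ≤Mω (𝒜 ⊕ᴹ ℬ)
⇒ᴹ-adjointˡ 𝒜 ℬ 𝒞 𝒜⇒𝒞≤ℬ = reduction⇒≤Mω 𝒞 (𝒜 ⊕ᴹ ℬ) _ reduce
  where
  Θ : Code 1
  Θ = proj₁ 𝒜⇒𝒞≤ℬ

  reduce : Reduction (decoderᶜ [oracle≔ prependᶜ oracle (interleaveᶜ evensᶜ (Θ [oracle≔ prependᶜ oracle oddsᶜ ])) ])
                     𝒞 (𝒜 ⊕ᴹ ℬ)
  reduce n F (evens∈ , odds∈) with ≤Mω⇒reduction (𝒜 ⇒ᴹ 𝒞) ℬ 𝒜⇒𝒞≤ℬ n (odds F) odds∈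
  ... | h , Θ↦h , h∈ with h∈ (evens F) evens∈
  ... | H , decoder↦H , H∈ =
    H , ⟦⟧↦-compose (prependᶜ-↦ ev-oracle (interleaveᶜ-↦ evensᶜ-↦ (⟦⟧↦-compose n⌢odds↦ Θ↦h))) decoder↦H , H∈
    where
    n⌢odds↦ : prependᶜ oracle oddsᶜ ⟦ n ⌢ F ⟧↦ (n ⌢ odds F)
    n⌢odds↦ = prependᶜ-↦ ev-oracle oddsᶜ-↦

proposition3p3 : IsBrouwerAlgebra ωMassProblem _≤Mω_
proposition3p3 = record
  { refl = λ {𝒜} → ≤Mω-refl {𝒜}
  ; trans = λ {𝒜} {ℬ} {𝒞} → ≤Mω-trans {𝒜} {ℬ} {𝒞}
  ; _⊕_ = _⊕ᴹ_
  ; _⊗_ = _⊗ᴹ_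
  ; _⇒_ = _⇒ᴹ_
  ; 𝟎 = 𝟎ᴹ
  ; 𝟏 = 𝟏ᴹ
  ; 𝟎-least = 𝟎ᴹ-least
  ; 𝟏-greatest = 𝟏ᴹ-greatest
  ; ⊕-upperˡ = ⊕ᴹ-upperˡ
  ; ⊕-upperʳ = ⊕ᴹ-upperʳ
  ; ⊕-least = ⊕ᴹ-least
  ; ⊗-lowerˡ = ⊗ᴹ-lowerˡ
  ; ⊗-lowerʳ = ⊗ᴹ-lowerʳ
  ; ⊗-greatest = ⊗ᴹ-greatest
  ; distrib = ⊗ᴹ-distrib-⊕ᴹ
  ; ⇒-adj = λ 𝒜 ℬ 𝒞 → mk⇔ (⇒ᴹ-adjointʳ 𝒜 ℬ 𝒞) (⇒ᴹ-adjointˡ 𝒜 ℬ 𝒞)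
  }
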